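{- Let $(y_n)_{n\ge 1}$ be a nondecreasing sequence of positive integers with output array $A(n,k)$. Fix a positive integer $n$, and let $K$ denote the largest integer $m\ge 0$ for which $A(n+1,m+1)>0$. Suppose $k\ge 0$ is an integer with $k+1\le K$. Then $$A(n+1,k+1)=A(n+1,k)+A(n,k+1)$$ and $$A(n+1,k+1)=\sum_{j=0}^{k+1}A(n,j).$$
   Context: Let $(y_n)_{n\ge1}$ be a nondecreasing sequence of positive integers (an input sequence). For a positive integer $n$, an $n$-tuple $\mathbf{x}=(x_1,\dots,x_n)$ of nonnegative integers is called valid for $(y_n)$ if $x_1\le y_n$ and $x_{j+1}\le \min(x_j,y_{n-j})$ for $1\le j\le n-1$. For $n\ge1$ and $k\ge0$, $A(n,k)$ denotes the number of valid $n$-tuples with $x_1=k$; the array $(A(n,k))$ is the output array of $(y_n)$. -}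

module Defs where

open import Data.Nat using (ℕ; zero; suc; _≤_; _≤?_)
open import Data.Nat.Properties using ()
open import Data.Vec using (Vec; []; _∷_)
open import Data.List using (List; []; _∷_; map; concatMap; upTo; filter; length)
open import Data.Product using (_×_; _,_)
open import Data.Unit using (⊤; tt)
open import Relation.Nullary using (Dec; yes; no)
open import Relation.Nullary.Decidable using (_×-dec_)

-- Input sequences are functions y : ℕ → ℕ, indexed from 1 (the value y 0 is irrelevant).
Positive : (ℕ → ℕ) → Set
Positive y = ∀ n → 1 ≤ n → 1 ≤ y n

Nondecreasing : (ℕ → ℕ) → Set
Nondecreasing y = ∀ m n → 1 ≤ m → m ≤ n → y m ≤ y n

-- Validity of the tail (x_{j+1}, ..., x_n) of a tuple of length n, given prev = x_j.
-- The tail has length r = n - j; its first entry x_{j+1} must satisfy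
-- x_{j+1} ≤ x_j and x_{j+1} ≤ y_{n-j} = y_r.
ValidTail : (y : ℕ → ℕ) → (r : ℕ) → (prev : ℕ) → Vec ℕ r → Set
ValidTail y zero    prev []       = ⊤
ValidTail y (suc r) prev (x ∷ xs) = (x ≤ prev) × (x ≤ y (suc r)) × ValidTail y r x xs

Valid : (y : ℕ → ℕ) → (n : ℕ) → Vec ℕ n → Set
Valid y zero    []       = ⊤
Valid y (suc m) (x ∷ xs) = (x ≤ y (suc m)) × ValidTail y m x xs

validTail? : (y : ℕ → ℕ) → (r : ℕ) → (prev : ℕ) → (xs : Vec ℕ r) → Dec (ValidTail y r prev xs)
validTail? y zero    prev []       = yes tt
validTail? y (suc r) prev (x ∷ xs) = (x ≤? prev) ×-dec ((x ≤? y (suc r)) ×-dec validTail? y r x xs)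

valid? : (y : ℕ → ℕ) → (n : ℕ) → (xs : Vec ℕ n) → Dec (Valid y n xs)
valid? y zero    []       = yes tt
valid? y (suc m) (x ∷ xs) = (x ≤? y (suc m)) ×-dec validTail? y m x xs

boundedVecs : (m : ℕ) → (b : ℕ) → List (Vec ℕ m)
boundedVecs zero    b = [] ∷ []
boundedVecs (suc m) b = concatMap (λ x → map (x ∷_) (boundedVecs m b)) (upTo (suc b))

-- A valid tuple with x_1 = k has all entries ≤ k (x_{j+1} ≤ x_j), so it suffices
-- to enumerate the tuples (k, x_2, ..., x_n) with x_2, ..., x_n ∈ {0, ..., k}.
-- (A y 0 k = 0 by convention; n ≥ 1 in the paper.)
A : (y : ℕ → ℕ) → ℕ → ℕ → ℕ
A y zero    k = 0
A y (suc m) k = length (filter (λ xs → valid? y (suc m) (k ∷ xs)) (boundedVecs m k))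

{-# OPTIONS --safe #-}
module Submission where

-- A valid (m+2)-tuple starting with k ≤ y (m+2) is k followed by a valid (m+1)-tuple
-- starting with some j ≤ k, so A (m+2) k = Σ_{j ≤ k} A (m+1) j; the constraint
-- x₂ ≤ y (m+1) is already built into A (m+1) j.  Below K+1 the bound k ≤ y (n+1)
-- follows from A (n+1) (K+1) > 0, and both identities are this recurrence.

open import Defs
open import Data.Nat using (ℕ; zero; suc; _+_; _≤_; _<_; _≤?_; s≤s)
open import Data.Nat.Properties using (≤-refl; ≤-trans; n≤1+n; m<n⇒m<1+n; m≤n⇒m<n∨m≡n; <⇒≱; ≤-pred; +-identityʳ)
open import Data.List using (List; []; _∷_; _++_; map; upTo; filter; length; concatMap)
open import Data.List.Properties using (upTo-∷ʳ; map-++; map-cong; length-++; filter-++; filter-≐; filter-none)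
open import Data.List.Relation.Unary.All using (universal)
open import Data.Vec using (_∷_)
open import Data.Nat.ListAction using (sum)
open import Data.Nat.ListAction.Properties using (sum-++)
open import Data.Product using (_×_; _,_; proj₁; proj₂)
open import Data.Bool using (true; false)
open import Data.Sum using (inj₁; inj₂)
open import Data.Empty using (⊥-elim)
open import Function using (_∘_)
open import Level using (Level)
open import Relation.Nullary using (Dec; yes; no; does; ¬_)
open import Relation.Nullary.Decidable using (_×-dec_)
open import Relation.Unary using (Pred; Decidable)
open import Relation.Binary.PropositionalEquality using (_≡_; refl; sym; trans; cong; cong₂; subst; module ≡-Reasoning)

when : {ℓ : Level} {P : Set ℓ} → Dec P → ℕ → ℕ
when (yes _) n = n
when (no _)  n = 0

when-yes : {ℓ : Level} {P : Set ℓ} {n : ℕ} → P → (d : Dec P) → when d n ≡ n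
when-yes p (yes _) = refl
when-yes p (no ¬p) = ⊥-elim (¬p p)

when-no : {ℓ : Level} {P : Set ℓ} {n : ℕ} → ¬ P → (d : Dec P) → when d n ≡ 0
when-no ¬p (yes p) = ⊥-elim (¬p p)
when-no ¬p (no _)  = refl

when-pos : {ℓ : Level} {P : Set ℓ} {n : ℕ} (d : Dec P) → 0 < when d n → P
when-pos (yes p) _ = p

Σ< : ℕ → (ℕ → ℕ) → ℕ
Σ< zero    f = 0
Σ< (suc n) f = Σ< n f + f n

sum-map-upTo : ∀ n (f : ℕ → ℕ) → sum (map f (upTo n)) ≡ Σ< n f
sum-map-upTo zero    f = refl
sum-map-upTo (suc n) f = begin
  sum (map f (upTo (suc n)))       ≡⟨ cong (sum ∘ map f) (sym (upTo-∷ʳ n)) ⟩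
  sum (map f (upTo n ++ n ∷ []))   ≡⟨ cong sum (map-++ f (upTo n) (n ∷ [])) ⟩
  sum (map f (upTo n) ++ f n ∷ []) ≡⟨ sum-++ (map f (upTo n)) (f n ∷ []) ⟩
  sum (map f (upTo n)) + (f n + 0) ≡⟨ cong₂ _+_ (sum-map-upTo n f) (+-identityʳ (f n)) ⟩
  Σ< n f + f n                     ∎
  where open ≡-Reasoning

Σ<-cong : ∀ n {f g : ℕ → ℕ} → (∀ x → x < n → f x ≡ g x) → Σ< n f ≡ Σ< n g
Σ<-cong zero    f≡g = refl
Σ<-cong (suc n) f≡g = cong₂ _+_ (Σ<-cong n (λ x x<n → f≡g x (m<n⇒m<1+n x<n))) (f≡g n ≤-refl)

Σ<-when-≤ : ∀ p (g : ℕ → ℕ) n → p < n → Σ< n (λ x → when (x ≤? p) (g x)) ≡ Σ< (suc p) g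
Σ<-when-≤ p g (suc n) (s≤s p≤n) with m≤n⇒m<n∨m≡n p≤n
... | inj₁ p<n = trans (cong₂ _+_ (Σ<-when-≤ p g n p<n) (when-no (<⇒≱ p<n) (n ≤? p))) (+-identityʳ _)
... | inj₂ refl = Σ<-cong (suc p) (λ x x<1+p → when-yes (≤-pred x<1+p) (x ≤? p))

module _ {a p : Level} {A : Set a} {P : Pred A p} (P? : Decidable P) where

  length-filter-++ : (xs ys : List A) →
    length (filter P? (xs ++ ys)) ≡ length (filter P? xs) + length (filter P? ys)
  length-filter-++ xs ys = trans (cong length (filter-++ P? xs ys)) (length-++ (filter P? xs))

  length-filter-concatMap : {b : Level} {B : Set b} (g : B → List A) (l : List B) →
    length (filter P? (concatMap g l)) ≡ sum (map (length ∘ filter P? ∘ g) l)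
  length-filter-concatMap g []      = refl
  length-filter-concatMap g (x ∷ l) =
    trans (length-filter-++ (g x) (concatMap g l)) (cong (_ +_) (length-filter-concatMap g l))

  length-filter-map : {b : Level} {B : Set b} (f : B → A) (l : List B) →
    length (filter P? (map f l)) ≡ length (filter (P? ∘ f) l)
  length-filter-map f []      = refl
  length-filter-map f (x ∷ l) with does (P? (f x))
  ... | true  = cong suc (length-filter-map f l)
  ... | false = length-filter-map f l

  length-filter-×-dec : {q : Level} {Q : Set q} (Q? : Dec Q) (l : List A) →
    length (filter (λ z → Q? ×-dec P? z) l) ≡ when Q? (length (filter P? l))
  length-filter-×-dec (yes q) l = cong length (filter-≐ _ P? (proj₂ , (q ,_)) l)
  length-filter-×-dec (no ¬q) l = cong length (filter-none _ (universal (λ _ → ¬q ∘ proj₁) l))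

module OutputArray (y : ℕ → ℕ) where

  tailCount : ℕ → ℕ → ℕ → ℕ
  tailCount r p b = length (filter (validTail? y r p) (boundedVecs r b))

  tailCount-suc : ∀ r p b →
    tailCount (suc r) p b ≡ Σ< (suc b) (λ x → when (x ≤? p) (when (x ≤? y (suc r)) (tailCount r x b)))
  tailCount-suc r p b = begin
    tailCount (suc r) p b
      ≡⟨ length-filter-concatMap (validTail? y (suc r) p) (λ x → map (x ∷_) (boundedVecs r b)) (upTo (suc b)) ⟩
    sum (map (λ x → length (filter (validTail? y (suc r) p) (map (x ∷_) (boundedVecs r b)))) (upTo (suc b)))
      ≡⟨ cong sum (map-cong first-entry (upTo (suc b))) ⟩
    sum (map (λ x → when (x ≤? p) (when (x ≤? y (suc r)) (tailCount r x b))) (upTo (suc b)))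
      ≡⟨ sum-map-upTo (suc b) _ ⟩
    Σ< (suc b) (λ x → when (x ≤? p) (when (x ≤? y (suc r)) (tailCount r x b))) ∎
    where
    open ≡-Reasoning
    first-entry : ∀ x → length (filter (validTail? y (suc r) p) (map (x ∷_) (boundedVecs r b)))
                      ≡ when (x ≤? p) (when (x ≤? y (suc r)) (tailCount r x b))
    first-entry x = begin
      length (filter (validTail? y (suc r) p) (map (x ∷_) (boundedVecs r b)))
        ≡⟨ length-filter-map (validTail? y (suc r) p) (x ∷_) (boundedVecs r b) ⟩
      length (filter (λ xs → (x ≤? p) ×-dec ((x ≤? y (suc r)) ×-dec validTail? y r x xs)) (boundedVecs r b))
        ≡⟨ length-filter-×-dec (λ xs → (x ≤? y (suc r)) ×-dec validTail? y r x xs) (x ≤? p) (boundedVecs r b) ⟩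
      when (x ≤? p) (length (filter (λ xs → (x ≤? y (suc r)) ×-dec validTail? y r x xs) (boundedVecs r b)))
        ≡⟨ cong (when (x ≤? p)) (length-filter-×-dec (validTail? y r x) (x ≤? y (suc r)) (boundedVecs r b)) ⟩
      when (x ≤? p) (when (x ≤? y (suc r)) (tailCount r x b)) ∎

  tailCount-suc-≤ : ∀ r p b → p ≤ b →
    tailCount (suc r) p b ≡ Σ< (suc p) (λ x → when (x ≤? y (suc r)) (tailCount r x b))
  tailCount-suc-≤ r p b p≤b = trans (tailCount-suc r p b) (Σ<-when-≤ p _ (suc b) (s≤s p≤b))

  -- Entries of a valid tail never exceed the entry before it, so the range bound b is irrelevant.
  tailCount-bound-irrelevant : ∀ r p b → p ≤ b → tailCount r p b ≡ tailCount r p p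
  tailCount-bound-irrelevant zero    p b p≤b = refl
  tailCount-bound-irrelevant (suc r) p b p≤b = begin
    tailCount (suc r) p b                                      ≡⟨ tailCount-suc-≤ r p b p≤b ⟩
    Σ< (suc p) (λ x → when (x ≤? y (suc r)) (tailCount r x b)) ≡⟨ Σ<-cong (suc p) shrink-bound ⟩
    Σ< (suc p) (λ x → when (x ≤? y (suc r)) (tailCount r x p)) ≡⟨ tailCount-suc-≤ r p p ≤-refl ⟨
    tailCount (suc r) p p                                      ∎
    where
    open ≡-Reasoning
    shrink-bound : ∀ x → x < suc p →
      when (x ≤? y (suc r)) (tailCount r x b) ≡ when (x ≤? y (suc r)) (tailCount r x p)
    shrink-bound x (s≤s x≤p) = cong (when (x ≤? y (suc r)))
      (trans (tailCount-bound-irrelevant r x b (≤-trans x≤p p≤b))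
             (sym (tailCount-bound-irrelevant r x p x≤p)))

  A-suc : ∀ m k → A y (suc m) k ≡ when (k ≤? y (suc m)) (tailCount m k k)
  A-suc m k = length-filter-×-dec (validTail? y m k) (k ≤? y (suc m)) (boundedVecs m k)

  A-pos⇒≤ : ∀ m k → 0 < A y (suc m) k → k ≤ y (suc m)
  A-pos⇒≤ m k A>0 = when-pos (k ≤? y (suc m)) (subst (0 <_) (A-suc m k) A>0)

  -- The recurrence fails for m = 0, where the convention A y 0 j = 0 applies.
  A-recurrence : ∀ m k → k ≤ y (suc (suc m)) → A y (suc (suc m)) k ≡ Σ< (suc k) (A y (suc m))
  A-recurrence m k k≤y = begin
    A y (suc (suc m)) k
      ≡⟨ A-suc (suc m) k ⟩
    when (k ≤? y (suc (suc m))) (tailCount (suc m) k k)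
      ≡⟨ when-yes k≤y (k ≤? y (suc (suc m))) ⟩
    tailCount (suc m) k k
      ≡⟨ tailCount-suc-≤ m k k ≤-refl ⟩
    Σ< (suc k) (λ x → when (x ≤? y (suc m)) (tailCount m x k))
      ≡⟨ Σ<-cong (suc k) (λ x x<1+k → cong (when (x ≤? y (suc m)))
           (tailCount-bound-irrelevant m x k (≤-pred x<1+k))) ⟩
    Σ< (suc k) (λ x → when (x ≤? y (suc m)) (tailCount m x x))
      ≡⟨ Σ<-cong (suc k) (λ x _ → A-suc m x) ⟨
    Σ< (suc k) (A y (suc m)) ∎
    where open ≡-Reasoning

open OutputArray using (A-pos⇒≤; A-recurrence)

theorem2p2 : (y : ℕ → ℕ) → Positive y → Nondecreasing y →
    (n : ℕ) → 1 ≤ n →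
    (K : ℕ) → 0 < A y (suc n) (suc K) → (∀ m → 0 < A y (suc n) (suc m) → m ≤ K) →
    (k : ℕ) → suc k ≤ K →
    (A y (suc n) (suc k) ≡ A y (suc n) k + A y n (suc k))
      × (A y (suc n) (suc k) ≡ sum (map (A y n) (upTo (suc (suc k)))))
theorem2p2 y _ _ (suc m) _ K A[K+1]>0 _ k k<K = pascal , partial-sum
  where
  k+1≤y : suc k ≤ y (suc (suc m))
  k+1≤y = ≤-trans (≤-trans k<K (n≤1+n K)) (A-pos⇒≤ y (suc m) (suc K) A[K+1]>0)

  pascal : A y (suc (suc m)) (suc k) ≡ A y (suc (suc m)) k + A y (suc m) (suc k)
  pascal = trans (A-recurrence y m (suc k) k+1≤y)
    (cong (_+ A y (suc m) (suc k)) (sym (A-recurrence y m k (≤-trans (n≤1+n k) k+1≤y))))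

  partial-sum : A y (suc (suc m)) (suc k) ≡ sum (map (A y (suc m)) (upTo (suc (suc k))))
  partial-sum = trans (A-recurrence y m (suc k) k+1≤y) (sym (sum-map-upTo (suc (suc k)) (A y (suc m))))
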